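{- Let $a,b,c$ be non-zero setwise coprime integers, $d\geq1$ an integer, $q$ a prime, and $L,M,N\geq1$ real numbers with $$LMN\leq\frac16\,q^{\frac12\cdot\frac{1}{d\max(|a|,|b|,|c|)}}.$$ Then $N_{a,b,c,d}(L,M,N;q)=0$.
   Context: $N_{a,b,c,d}(L,M,N;q)$ is the number of integer triples $(l,m,n)$ with $L<l\leq 2L$, $M<m\leq 2M$, $N<n\leq 2N$, $q\nmid lmn$, $(l^am^bn^c)^d\equiv 1\pmod q$ (computed in $\mathbf{F}_q^\times$) and $l^am^bn^c\neq 1$ as a rational number.
   Formalization: The parameters L, M, N range over the rationals rather than the real numbers. -}

module Defs where

open import Data.Nat as ℕ using (ℕ; zero; suc; _^_; _⊔_)
open import Data.Nat.Properties as ℕP using ()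
open import Data.Nat.GCD using (gcd)
open import Data.Nat.Divisibility using (_∣_; _∣?_)
open import Data.Integer as ℤ using (ℤ; +_; -[1+_]; ∣_∣)
open import Data.Rational as ℚ using (ℚ; _/_; floor)
open import Data.Rational.Properties using (_<?_; _≤?_)
open import Data.List using (List; filter; upTo; cartesianProduct; length; map)
open import Data.Product using (_×_; _,_)
open import Relation.Nullary using (¬_; Dec)
open import Relation.Nullary.Decidable using (_×-dec_; ¬?)
open import Relation.Binary.PropositionalEquality using (_≡_; _≢_)

ℕ→ℚ : ℕ → ℚ
ℕ→ℚ n = + n / 1

_^ℚ_ : ℚ → ℕ → ℚ
x ^ℚ zero  = ℚ.1ℚ
x ^ℚ suc k = x ℚ.* (x ^ℚ k)

pos : ℤ → ℕ
pos (+ n)    = n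
pos -[1+ n ] = 0

neg : ℤ → ℕ
neg (+ n)    = 0
neg -[1+ n ] = suc n

_≡_[mod_] : ℕ → ℕ → ℕ → Set
x ≡ y [mod q ] = q ∣ ∣ + x ℤ.- + y ∣

-- the integers l with L < l ≤ 2L (listed as naturals; correct when L ≥ 1)
dyadic : ℚ → List ℕ
dyadic L = filter (λ l → (L <? ℕ→ℚ l) ×-dec (ℕ→ℚ l ≤? (ℕ→ℚ 2 ℚ.* L)))
                  (upTo (suc ∣ floor (ℕ→ℚ 2 ℚ.* L) ∣))

-- For the rational number r = l^a m^b n^c we write r = num / den with
-- num = l^{a⁺} m^{b⁺} n^{c⁺}, den = l^{a⁻} m^{b⁻} n^{c⁻}.
module _ (a b c : ℤ) (l m n : ℕ) where
  num den : ℕ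
  num = (l ^ pos a) ℕ.* (m ^ pos b) ℕ.* (n ^ pos c)
  den = (l ^ neg a) ℕ.* (m ^ neg b) ℕ.* (n ^ neg c)

-- The defining condition of N_{a,b,c,d}(L,M,N;q) for a triple (l,m,n):
--  q ∤ lmn,  (l^a m^b n^c)^d ≡ 1 in F_q^×  (i.e. num^d ≡ den^d mod q),
--  and l^a m^b n^c ≠ 1 as a rational (i.e. num ≠ den).
Cond : ℤ → ℤ → ℤ → ℕ → ℕ → ℕ × ℕ × ℕ → Set
Cond a b c d q (l , m , n) =
  (¬ (q ∣ l ℕ.* m ℕ.* n)) × ((num a b c l m n ^ d) ≡ (den a b c l m n ^ d) [mod q ])
  × (num a b c l m n ≢ den a b c l m n)

Cond? : ∀ a b c d q t → Dec (Cond a b c d q t)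
Cond? a b c d q (l , m , n) =
  ¬? (q ∣? l ℕ.* m ℕ.* n) ×-dec (q ∣? _) ×-dec ¬? (num a b c l m n ℕ.≟ den a b c l m n)

Ncount : ℤ → ℤ → ℤ → ℕ → ℚ → ℚ → ℚ → ℕ → ℕ
Ncount a b c d L M N q =
  length (filter (Cond? a b c d q)
    (cartesianProduct (dyadic L) (cartesianProduct (dyadic M) (dyadic N))))

SetwiseCoprime : ℤ → ℤ → ℤ → Set
SetwiseCoprime a b c = gcd (gcd ∣ a ∣ ∣ b ∣) ∣ c ∣ ≡ 1

maxAbs : ℤ → ℤ → ℤ → ℕ
maxAbs a b c = ∣ a ∣ ⊔ ∣ b ∣ ⊔ ∣ c ∣

-- Write l^a m^b n^c = u / v with u = num, v = den.  Both are monomials in l, m, n with exponents at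
-- most K = max(|a|, |b|, |c|), so 1 ≤ u^d, v^d ≤ (lmn)^(dK).  In the box lmn ≤ 8LMN ≤ (6LMN)^2, so the
-- hypothesis gives (lmn)^(dK) ≤ q.  Two numbers in [1, q] that are congruent mod q are equal, hence
-- u^d = v^d and u = v, contradicting l^a m^b n^c ≠ 1.
module Submission where

open import Defs
open import Data.Nat using (ℕ; _≥_; _*_)
open import Data.Nat.Primality using (Prime)
open import Data.Integer using (ℤ; +_)
open import Data.Rational as ℚ using (ℚ)
open import Relation.Binary.PropositionalEquality using (_≡_; _≢_)

open import Data.Nat using (zero; suc; _+_; _^_; _≤_; _<_; _∸_; _⊔_; z≤n; NonZero; ≢-nonZero; >-nonZero)
open import Data.Nat.Properties
open import Data.Nat.Divisibility using (_∣_; _∣0; >⇒∤)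
import Data.Nat.Coprimality as Coprimality
open import Algebra.Properties.CommutativeSemigroup *-commutativeSemigroup using (interchange)
import Data.Integer as ℤ
import Data.Integer.Properties as ℤ
import Data.Rational.Properties as ℚ
open import Data.Rational.Solver using (module +-*-Solver)
open import Data.List using (length; cartesianProduct)
open import Data.List.Properties using (filter-none)
open import Data.List.Membership.Propositional using (_∈_)
open import Data.List.Membership.Propositional.Properties using (∈-filter⁻; ∈-cartesianProduct⁻)
open import Data.List.Relation.Unary.All using (tabulate)
open import Data.Product using (_,_; proj₁; proj₂)
open import Relation.Nullary.Decidable using (_×-dec_)
open import Relation.Binary.Definitions using (tri<; tri≈; tri>)
open import Relation.Binary.PropositionalEquality
  using (refl; sym; trans; cong; cong₂; subst; subst₂; module ≡-Reasoning)
open import Relation.Nullary using (¬_; contradiction)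

^-injectiveˡ : ∀ k .{{_ : NonZero k}} {x y} → x ^ k ≡ y ^ k → x ≡ y
^-injectiveˡ k {x} {y} xᵏ≡yᵏ with <-cmp x y
... | tri< x<y _ _ = contradiction xᵏ≡yᵏ (<⇒≢ (^-monoˡ-< k x<y))
... | tri≈ _ x≡y _ = x≡y
... | tri> _ _ y<x = contradiction (sym xᵏ≡yᵏ) (<⇒≢ (^-monoˡ-< k y<x))

^-distribʳ-* : ∀ m n k → (m * n) ^ k ≡ m ^ k * n ^ k
^-distribʳ-* m n zero    = refl
^-distribʳ-* m n (suc k) = trans (cong (m * n *_) (^-distribʳ-* m n k)) (interchange m n (m ^ k) (n ^ k))

∣+m-+n∣≡m∸n : ∀ {m n} → n ≤ m → ℤ.∣ + m ℤ.- + n ∣ ≡ m ∸ n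
∣+m-+n∣≡m∸n {m} {n} n≤m = cong ℤ.∣_∣ (trans (ℤ.m-n≡m⊖n m n) (ℤ.⊖-≥ n≤m))

≢-mod-< : ∀ {q x y} → 0 < y → y < x → x ≤ q → ¬ (x ≡ y [mod q ])
≢-mod-< {q} 0<y y<x x≤q q∣x-y =
  >⇒∤ {{≢-nonZero (m>n⇒m∸n≢0 y<x)}} (<-≤-trans (∸-monoʳ-< 0<y (<⇒≤ y<x)) x≤q)
      (subst (q ∣_) (∣+m-+n∣≡m∸n (<⇒≤ y<x)) q∣x-y)

≡-mod⇒≡ : ∀ {q x y} → 0 < x → 0 < y → x ≤ q → y ≤ q → x ≡ y [mod q ] → x ≡ y
≡-mod⇒≡ {q} {x} {y} 0<x 0<y x≤q y≤q x≡y with <-cmp x y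
... | tri< x<y _ _ = contradiction (subst (q ∣_) (ℤ.∣i-j∣≡∣j-i∣ (+ x) (+ y)) x≡y)
                                  (≢-mod-< 0<x x<y y≤q)
... | tri≈ _ x≡y _ = x≡y
... | tri> _ _ y<x = contradiction x≡y (≢-mod-< 0<y y<x x≤q)

pos≤∣_∣ : ∀ a → pos a ≤ ℤ.∣ a ∣
pos≤∣ + n    ∣ = ≤-refl
pos≤∣ ℤ.-[1+ n ] ∣ = z≤n

neg≤∣_∣ : ∀ a → neg a ≤ ℤ.∣ a ∣
neg≤∣ + n    ∣ = z≤n
neg≤∣ ℤ.-[1+ n ] ∣ = ≤-refl

module _ (a b c : ℤ) {l m n : ℕ} .{{_ : NonZero l}} .{{_ : NonZero m}} .{{_ : NonZero n}} where

  monomial-nonZero : (e : ℤ → ℕ) → NonZero (l ^ e a * m ^ e b * n ^ e c)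
  monomial-nonZero e = m*n≢0 _ _ {{m*n≢0 _ _ {{m^n≢0 l (e a)}} {{m^n≢0 m (e b)}}}} {{m^n≢0 n (e c)}}

  monomial≤ : (e : ℤ → ℕ) → (∀ x → e x ≤ ℤ.∣ x ∣) →
              l ^ e a * m ^ e b * n ^ e c ≤ (l * m * n) ^ maxAbs a b c
  monomial≤ e e≤∣∣ = begin
    l ^ e a * m ^ e b * n ^ e c  ≤⟨ *-mono-≤ (*-mono-≤ (^-monoʳ-≤ l ea≤K) (^-monoʳ-≤ m eb≤K))
                                             (^-monoʳ-≤ n ec≤K) ⟩
    l ^ K * m ^ K * n ^ K        ≡⟨ cong (_* n ^ K) (^-distribʳ-* l m K) ⟨
    (l * m) ^ K * n ^ K          ≡⟨ ^-distribʳ-* (l * m) n K ⟨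
    (l * m * n) ^ K              ∎
    where
    open ≤-Reasoning
    K = maxAbs a b c
    ea≤K = ≤-trans (e≤∣∣ a) (≤-trans (m≤m⊔n ℤ.∣ a ∣ ℤ.∣ b ∣) (m≤m⊔n _ ℤ.∣ c ∣))
    eb≤K = ≤-trans (e≤∣∣ b) (≤-trans (m≤n⊔m ℤ.∣ a ∣ ℤ.∣ b ∣) (m≤m⊔n _ ℤ.∣ c ∣))
    ec≤K = ≤-trans (e≤∣∣ c) (m≤n⊔m (ℤ.∣ a ∣ ⊔ ℤ.∣ b ∣) ℤ.∣ c ∣)

Cond⇒q<[lmn]^dK : ∀ a b c d .{{_ : NonZero d}} q {l m n} → Cond a b c d q (l , m , n) →
                  q < (l * m * n) ^ (d * maxAbs a b c)
Cond⇒q<[lmn]^dK a b c d q {l} {m} {n} (q∤lmn , uᵈ≡vᵈ , u≢v) = ≰⇒> λ T≤q →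
  u≢v (^-injectiveˡ d (≡-mod⇒≡ (positive pos) (positive neg) (≤-trans (bound pos pos≤∣_∣) T≤q)
                                 (≤-trans (bound neg neg≤∣_∣) T≤q) uᵈ≡vᵈ))
  where
  K = maxAbs a b c
  instance
    lmn≢0 : NonZero (l * m * n)
    lmn≢0 = ≢-nonZero λ lmn≡0 → q∤lmn (subst (q ∣_) (sym lmn≡0) (q ∣0))
    lm≢0 : NonZero (l * m)
    lm≢0 = m*n≢0⇒m≢0 (l * m)
    l≢0 : NonZero l
    l≢0 = m*n≢0⇒m≢0 l
    m≢0 : NonZero m
    m≢0 = m*n≢0⇒n≢0 l
    n≢0 : NonZero n
    n≢0 = m*n≢0⇒n≢0 (l * m)

  positive : (e : ℤ → ℕ) → 0 < (l ^ e a * m ^ e b * n ^ e c) ^ d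
  positive e = m^n>0 _ {{monomial-nonZero a b c {l} {m} {n} e}} d

  bound : (e : ℤ → ℕ) → (∀ x → e x ≤ ℤ.∣ x ∣) →
          (l ^ e a * m ^ e b * n ^ e c) ^ d ≤ (l * m * n) ^ (d * K)
  bound e e≤∣∣ = subst ((l ^ e a * m ^ e b * n ^ e c) ^ d ≤_)
                       (trans (^-*-assoc (l * m * n) K d) (cong ((l * m * n) ^_) (*-comm K d)))
                       (^-monoˡ-≤ d (monomial≤ a b c {l} {m} {n} e e≤∣∣))

-- + n / 1 is normalised through a gcd that does not compute for a variable n; this canonical form
-- exposes numerator + n and denominator 1 definitionally.
ℕ→ℚ≡mkℚ : ∀ n → ℕ→ℚ n ≡ ℚ.mkℚ (+ n) 0 (Coprimality.sym (Coprimality.1-coprimeTo n))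
ℕ→ℚ≡mkℚ n = ℚ.↥p/↧p≡p _

ℕ→ℚ-mono-≤ : ∀ {m n} → m ≤ n → ℕ→ℚ m ℚ.≤ ℕ→ℚ n
ℕ→ℚ-mono-≤ {m} {n} m≤n = subst₂ ℚ._≤_ (sym (ℕ→ℚ≡mkℚ m)) (sym (ℕ→ℚ≡mkℚ n))
  (ℚ.*≤* (subst₂ ℤ._≤_ (sym (ℤ.*-identityʳ (+ m))) (sym (ℤ.*-identityʳ (+ n))) (ℤ.+≤+ m≤n)))

ℕ→ℚ-cancel-≤ : ∀ {m n} → ℕ→ℚ m ℚ.≤ ℕ→ℚ n → m ≤ n
ℕ→ℚ-cancel-≤ {m} {n} m≤n with subst₂ ℚ._≤_ (ℕ→ℚ≡mkℚ m) (ℕ→ℚ≡mkℚ n) m≤n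
... | ℚ.*≤* m*1≤n*1 = ℤ.drop‿+≤+ (subst₂ ℤ._≤_ (ℤ.*-identityʳ (+ m)) (ℤ.*-identityʳ (+ n)) m*1≤n*1)

ℕ→ℚ-homo-* : ∀ m n → ℕ→ℚ (m * n) ≡ ℕ→ℚ m ℚ.* ℕ→ℚ n
ℕ→ℚ-homo-* m n = trans (ℚ./-cong (ℤ.pos-* m n) refl) (sym (cong₂ ℚ._*_ (ℕ→ℚ≡mkℚ m) (ℕ→ℚ≡mkℚ n)))

ℕ→ℚ-nonNeg : ∀ n → ℚ.0ℚ ℚ.≤ ℕ→ℚ n
ℕ→ℚ-nonNeg n = ℕ→ℚ-mono-≤ {0} {n} z≤n

*-mono-≤-nonNeg : ∀ {p q r s} → p ℚ.≤ q → r ℚ.≤ s → ℚ.0ℚ ℚ.≤ q → ℚ.0ℚ ℚ.≤ r →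
                  p ℚ.* r ℚ.≤ q ℚ.* s
*-mono-≤-nonNeg {q = q} {r} p≤q r≤s 0≤q 0≤r =
  ℚ.≤-trans (ℚ.*-monoʳ-≤-nonNeg r {{ℚ.nonNegative 0≤r}} p≤q)
            (ℚ.*-monoˡ-≤-nonNeg q {{ℚ.nonNegative 0≤q}} r≤s)

*-nonNeg : ∀ {p q} → ℚ.0ℚ ℚ.≤ p → ℚ.0ℚ ℚ.≤ q → ℚ.0ℚ ℚ.≤ p ℚ.* q
*-nonNeg {p} {q} 0≤p 0≤q =
  ℚ.nonNegative⁻¹ _ {{ℚ.nonNeg*nonNeg⇒nonNeg p {{ℚ.nonNegative 0≤p}} q {{ℚ.nonNegative 0≤q}}}}

ℕ→ℚ-^-≤ : ∀ {n y} k → ℕ→ℚ n ℚ.≤ y → ℕ→ℚ (n ^ k) ℚ.≤ y ^ℚ k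
ℕ→ℚ-^-≤         zero    n≤y = ℚ.≤-refl
ℕ→ℚ-^-≤ {n} {y} (suc k) n≤y = begin
  ℕ→ℚ (n * n ^ k)           ≡⟨ ℕ→ℚ-homo-* n (n ^ k) ⟩
  ℕ→ℚ n ℚ.* ℕ→ℚ (n ^ k)     ≤⟨ *-mono-≤-nonNeg n≤y (ℕ→ℚ-^-≤ k n≤y) 0≤y (ℕ→ℚ-nonNeg (n ^ k)) ⟩
  y ℚ.* y ^ℚ k              ∎
  where
  open ℚ.≤-Reasoning
  0≤y = ℚ.≤-trans (ℕ→ℚ-nonNeg n) n≤y

^ℚ-square : ∀ x k → (x ℚ.* x) ^ℚ k ≡ x ^ℚ (2 * k)
^ℚ-square x zero    = refl
^ℚ-square x (suc k) = begin
  (x ℚ.* x) ℚ.* (x ℚ.* x) ^ℚ k  ≡⟨ cong ((x ℚ.* x) ℚ.*_) (^ℚ-square x k) ⟩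
  (x ℚ.* x) ℚ.* x ^ℚ (2 * k)    ≡⟨ ℚ.*-assoc x x _ ⟩
  x ^ℚ (2 + 2 * k)              ≡⟨ cong (x ^ℚ_) (*-distribˡ-+ 2 1 k) ⟨
  x ^ℚ (2 * suc k)              ∎
  where open ≡-Reasoning

∈-dyadic⇒≤ : ∀ {l R} → l ∈ dyadic R → ℕ→ℚ l ℚ.≤ ℕ→ℚ 2 ℚ.* R
∈-dyadic⇒≤ {R = R} l∈ =
  proj₂ (proj₂ (∈-filter⁻ (λ l → (R ℚ.<? ℕ→ℚ l) ×-dec (ℕ→ℚ l ℚ.≤? (ℕ→ℚ 2 ℚ.* R))) l∈))

module _ {L M N : ℚ} (1≤L : ℚ.1ℚ ℚ.≤ L) (1≤M : ℚ.1ℚ ℚ.≤ M) (1≤N : ℚ.1ℚ ℚ.≤ N) where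

  private
    X Y : ℚ
    X = ℕ→ℚ 6 ℚ.* L ℚ.* M ℚ.* N
    Y = L ℚ.* M ℚ.* N

    0≤L = ℚ.≤-trans (ℕ→ℚ-nonNeg 1) 1≤L
    0≤M = ℚ.≤-trans (ℕ→ℚ-nonNeg 1) 1≤M

    1≤LM : ℚ.1ℚ ℚ.≤ L ℚ.* M
    1≤LM = *-mono-≤-nonNeg 1≤L 1≤M 0≤L (ℕ→ℚ-nonNeg 1)

    1≤Y : ℚ.1ℚ ℚ.≤ Y
    1≤Y = *-mono-≤-nonNeg 1≤LM 1≤N (ℚ.≤-trans (ℕ→ℚ-nonNeg 1) 1≤LM) (ℕ→ℚ-nonNeg 1)

  dyadic-box-≤ : ∀ {l m n} → l ∈ dyadic L → m ∈ dyadic M → n ∈ dyadic N →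
                 ℕ→ℚ (l * m * n) ℚ.≤ X ℚ.* X
  dyadic-box-≤ {l} {m} {n} l∈ m∈ n∈ = begin
    ℕ→ℚ (l * m * n)                              ≡⟨ ℕ→ℚ-homo-*³ ⟩
    ℕ→ℚ l ℚ.* ℕ→ℚ m ℚ.* ℕ→ℚ n                    ≤⟨ lmn≤2L2M2N ⟩
    (two ℚ.* L) ℚ.* (two ℚ.* M) ℚ.* (two ℚ.* N)  ≡⟨ 2L2M2N≡8Y ⟩
    ℕ→ℚ 8 ℚ.* Y                                  ≤⟨ ℚ.*-monoʳ-≤-nonNeg Y {{ℚ.nonNegative 0≤Y}} 8≤36 ⟩
    ℕ→ℚ 36 ℚ.* Y                                 ≤⟨ ℚ.*-monoˡ-≤-nonNeg (ℕ→ℚ 36) {{ℚ.nonNegative 0≤36}} Y≤Y*Y ⟩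
    ℕ→ℚ 36 ℚ.* (Y ℚ.* Y)                         ≡⟨ 36Y²≡X² ⟩
    X ℚ.* X                                      ∎
    where
    open ℚ.≤-Reasoning
    open +-*-Solver
    two six : ℚ
    two = ℕ→ℚ 2
    six = ℕ→ℚ 6

    ℕ→ℚ-homo-*³ = trans (ℕ→ℚ-homo-* (l * m) n) (cong (ℚ._* ℕ→ℚ n) (ℕ→ℚ-homo-* l m))
    0≤2L = *-nonNeg (ℕ→ℚ-nonNeg 2) 0≤L
    0≤4LM = *-nonNeg 0≤2L (*-nonNeg (ℕ→ℚ-nonNeg 2) 0≤M)
    lmn≤2L2M2N = *-mono-≤-nonNeg (*-mono-≤-nonNeg (∈-dyadic⇒≤ {R = L} l∈) (∈-dyadic⇒≤ {R = M} m∈)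
                                                   0≤2L (ℕ→ℚ-nonNeg m))
                                 (∈-dyadic⇒≤ {R = N} n∈) 0≤4LM (ℕ→ℚ-nonNeg n)
    2L2M2N≡8Y = solve 4 (λ t L M N → (t :* L) :* (t :* M) :* (t :* N) := (t :* t :* t) :* (L :* M :* N))
                        refl two L M N
    8≤36 = ℕ→ℚ-mono-≤ (m≤m+n 8 28)
    0≤36 = ℕ→ℚ-nonNeg 36
    0≤Y = ℚ.≤-trans (ℕ→ℚ-nonNeg 1) 1≤Y
    Y≤Y*Y = subst (ℚ._≤ Y ℚ.* Y) (ℚ.*-identityʳ Y) (ℚ.*-monoˡ-≤-nonNeg Y {{ℚ.nonNegative 0≤Y}} 1≤Y)
    36Y²≡X² = solve 4 (λ s L M N → (s :* s) :* ((L :* M :* N) :* (L :* M :* N))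
                                   := (s :* L :* M :* N) :* (s :* L :* M :* N))
                      refl six L M N

  dyadic-box-^-≤ : ∀ {l m n} q k → l ∈ dyadic L → m ∈ dyadic M → n ∈ dyadic N →
                   X ^ℚ (2 * k) ℚ.≤ ℕ→ℚ q → (l * m * n) ^ k ≤ q
  dyadic-box-^-≤ {l} {m} {n} q k l∈ m∈ n∈ X²ᵏ≤q = ℕ→ℚ-cancel-≤ (begin
    ℕ→ℚ ((l * m * n) ^ k)  ≤⟨ ℕ→ℚ-^-≤ k (dyadic-box-≤ l∈ m∈ n∈) ⟩
    (X ℚ.* X) ^ℚ k         ≡⟨ ^ℚ-square X k ⟩
    X ^ℚ (2 * k)           ≤⟨ X²ᵏ≤q ⟩
    ℕ→ℚ q                  ∎)
    where open ℚ.≤-Reasoning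

lemma6p5 : (a b c : ℤ) → a ≢ + 0 → b ≢ + 0 → c ≢ + 0 → SetwiseCoprime a b c
    → (d : ℕ) → d ≥ 1 → (q : ℕ) → Prime q
    → (L M N : ℚ) → ℚ.1ℚ ℚ.≤ L → ℚ.1ℚ ℚ.≤ M → ℚ.1ℚ ℚ.≤ N
    → ((ℕ→ℚ 6 ℚ.* L ℚ.* M ℚ.* N) ^ℚ (2 * d * maxAbs a b c)) ℚ.≤ ℕ→ℚ q
    → Ncount a b c d L M N q ≡ 0
lemma6p5 a b c _ _ _ _ d d≥1 q _ L M N 1≤L 1≤M 1≤N X²ᵈᴷ≤q =
  cong length (filter-none (Cond? a b c d q) (tabulate no-solution))
  where
  K = maxAbs a b c

  no-solution : ∀ {t} → t ∈ cartesianProduct (dyadic L) (cartesianProduct (dyadic M) (dyadic N)) →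
                ¬ Cond a b c d q t
  no-solution {l , m , n} t∈ cond = <⇒≱ (Cond⇒q<[lmn]^dK a b c d {{>-nonZero d≥1}} q cond)
    (dyadic-box-^-≤ 1≤L 1≤M 1≤N q (d * K) l∈ m∈ n∈
      (subst (λ e → (ℕ→ℚ 6 ℚ.* L ℚ.* M ℚ.* N) ^ℚ e ℚ.≤ ℕ→ℚ q) (*-assoc 2 d K) X²ᵈᴷ≤q))
    where
    l∈×mn∈ = ∈-cartesianProduct⁻ (dyadic L) _ t∈
    m∈×n∈ = ∈-cartesianProduct⁻ (dyadic M) (dyadic N) (proj₂ l∈×mn∈)
    l∈ = proj₁ l∈×mn∈
    m∈ = proj₁ m∈×n∈
    n∈ = proj₂ m∈×n∈
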